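{- Let $p,q$ be primes with $2<p<q$. If $q\ge (p-3)p+3$, then $g=g_0$.
   Context: Let $p,q$ be primes with $2<p<q$, and put $p'=(p-1)/2$, $q'=(q-1)/2$. Set $d_0=pq$, $d_1=p'q$, $d_2=pq'$, $d_3=(pq-1)/2$, and for integers $x,y,z,w$ put $f(x,y,z,w)=xd_0+yd_1+zd_2+wd_3$. A positive integer is representable if it equals $f(x,y,z,w)$ for some nonnegative integers $x,y,z,w$. The Frobenius number $g$ is the largest positive integer that is not representable. Define $\kappa$ by $q=\kappa p+\lambda$ with $1\le\lambda\le p-1$, and put $g_0=f(p'-1,p-1,\kappa,-1)$. -}

module Defs where

open import Data.Nat as ℕ using (ℕ; _∸_)
open import Data.Nat.DivMod using (_/_)
open import Data.Integer as ℤ using (ℤ; +_; _+_; _*_; _<_)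
open import Data.Product using (Σ; ∃; _×_)
open import Relation.Binary.PropositionalEquality using (_≡_)
open import Relation.Nullary using (¬_)

p′ : ℕ → ℕ
p′ p = (p ∸ 1) / 2

q′ : ℕ → ℕ
q′ q = (q ∸ 1) / 2

d₀ d₁ d₂ d₃ : ℕ → ℕ → ℕ
d₀ p q = p ℕ.* q
d₁ p q = p′ p ℕ.* q
d₂ p q = p ℕ.* q′ q
d₃ p q = (p ℕ.* q ∸ 1) / 2

f : ℕ → ℕ → ℤ → ℤ → ℤ → ℤ → ℤ
f p q x y z w =
  x * + d₀ p q + y * + d₁ p q + z * + d₂ p q + w * + d₃ p q

Representable : ℕ → ℕ → ℤ → Set
Representable p q n =
  Σ ℕ λ x → Σ ℕ λ y → Σ ℕ λ z → Σ ℕ λ w →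
    f p q (+ x) (+ y) (+ z) (+ w) ≡ n

IsFrobeniusNumber : ℕ → ℕ → ℤ → Set
IsFrobeniusNumber p q g =
  (+ 0 < g) × (¬ Representable p q g) × (∀ m → g < m → Representable p q m)

g₀ : ℕ → ℕ → ℕ → ℤ
g₀ p q κ = f p q (+ p′ p ℤ.- + 1) (+ p ℤ.- + 1) (+ κ) (ℤ.- + 1)

{-# OPTIONS --safe #-}
-- Since 2d₁ = pq − q, 2d₂ = pq − p and 2d₃ = pq − 1, a natural number n equals f(x, y, z, w) exactly
-- when 2n + (yq + zp + w) = (2x + y + z + w)pq.  So n is representable iff some residue T = yq + zp + w
-- with 2n + T = k·pq is paid with y + z + w ≤ k coins, a number of the same parity as k.  Moreover
-- 2g₀ = σpq + λ + 1 with σ = 4(p′ − 1) + κ.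
-- Above g₀, take T < pq and its mixed-radix digits: they use at most σ + 3 coins, and σ + 3 only when
-- T ≥ pq − λ − 1, which forces k ≥ σ + 2; since k > σ in any case, parity gives y + z + w ≤ k.
-- At g₀, T + λ + 1 = j·pq; multiplying the coin budget by p and eliminating y and z yields an
-- identity that fails in every case; the case j = 1, zp + w + λ + 1 ≥ 2q is where q ≥ (p − 3)p + 3
-- is used.  Primality only serves to make p and q odd.

module Submission where

open import Defs
open import Data.Nat using (ℕ; zero; suc; pred; _+_; _*_; _∸_; _<_; _≤_; _≥_; z≤n; s≤s; NonZero)
open import Data.Nat.Properties
open import Data.Nat.DivMod using (_/_; _%_; m*n/n≡m; m≡m%n+[m/n]*n; m%n<n; m<n*o⇒m/o<n)
open import Data.Nat.Divisibility using (divides; ∣m+n∣m⇒∣n; ∣⇒≤)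
open import Data.Nat.Primality using (Prime; prime⇒irreducible; prime⇒nonZero)
open import Data.Nat.Tactic.RingSolver using (solve; solve-∀)
open import Data.List.Base using (_∷_; [])
open import Data.Integer as ℤ using (+<+)
import Data.Integer.Properties as ℤ
open import Data.Product using (Σ; ∃-syntax; _×_; _,_; proj₁; proj₂)
open import Data.Sum using (inj₁; inj₂)
open import Data.Empty using (⊥)
open import Relation.Nullary using (¬_; contradiction)
open import Relation.Binary.PropositionalEquality

multiple-gap : ∀ {m n k o} .{{_ : NonZero o}} → m * o + k ≡ n * o → ∃[ j ] (m + j ≡ n × k ≡ j * o)
multiple-gap {m} {n} {k} {o} eq
  with m≤n⇒∃[o]m+o≡n (*-cancelʳ-≤ m n o (subst (m * o ≤_) eq (m≤m+n (m * o) k)))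
... | j , refl = j , refl , +-cancelˡ-≡ (m * o) k (j * o) (trans eq (*-distribʳ-+ o m j))

round-up-to-multiple : ∀ m n .{{_ : NonZero n}} → ∃[ k ] ∃[ r ] (m + r ≡ k * n × r < n)
round-up-to-multiple m n = t / n , pred n ∸ t % n , m+r≡kn , m≤pred[n]⇒suc[m]≤n (m∸n≤m (pred n) (t % n))
  where
  open ≡-Reasoning
  t = m + pred n
  m+r≡kn : m + (pred n ∸ t % n) ≡ t / n * n
  m+r≡kn = begin
    m + (pred n ∸ t % n)       ≡⟨ +-∸-assoc m (<⇒≤pred (m%n<n t n)) ⟨
    t ∸ t % n                  ≡⟨ cong (_∸ t % n) (m≡m%n+[m/n]*n t n) ⟩
    t % n + t / n * n ∸ t % n  ≡⟨ m+n∸m≡n (t % n) (t / n * n) ⟩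
    t / n * n                  ∎

mixed-radix : ∀ {r p q} .{{_ : NonZero p}} .{{_ : NonZero q}} → r < p * q →
  ∃[ y ] ∃[ z ] ∃[ w ] (r ≡ y * q + z * p + w × y < p × z * p + w < q × w < p)
mixed-radix {r} {p} {q} r<pq =
  r / q , R / p , R % p , r≡ , m<n*o⇒m/o<n r<pq , subst (_< q) R≡ (m%n<n r q) , m%n<n R p
  where
  open ≡-Reasoning
  R = r % q
  R≡ : R ≡ R / p * p + R % p
  R≡ = trans (m≡m%n+[m/n]*n R p) (+-comm (R % p) _)
  r≡ : r ≡ r / q * q + R / p * p + R % p
  r≡ = begin
    r                                ≡⟨ m≡m%n+[m/n]*n r q ⟩
    R + r / q * q                    ≡⟨ +-comm R _ ⟩
    r / q * q + R                    ≡⟨ cong ((r / q * q) +_) R≡ ⟩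
    r / q * q + (R / p * p + R % p)  ≡⟨ +-assoc (r / q * q) _ _ ⟨
    r / q * q + R / p * p + R % p    ∎

SameParity : ℕ → ℕ → Set
SameParity m n = ∃[ a ] ∃[ b ] m + 2 * a ≡ n + 2 * b

sameParity∧≤⇒even-gap : ∀ {m n} → SameParity m n → m ≤ n → ∃[ x ] n ≡ m + 2 * x
sameParity∧≤⇒even-gap {m} (a , b , e) m≤n with m≤n⇒∃[o]m+o≡n m≤n
... | k , refl = a ∸ b , cong (m +_) (begin
    k                  ≡⟨ m+n∸n≡m k (2 * b) ⟨
    k + 2 * b ∸ 2 * b  ≡⟨ cong (_∸ 2 * b) k+2b≡2a ⟩
    2 * a ∸ 2 * b      ≡⟨ *-distribˡ-∸ 2 a b ⟨
    2 * (a ∸ b)        ∎)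
  where
  open ≡-Reasoning
  k+2b≡2a : k + 2 * b ≡ 2 * a
  k+2b≡2a = +-cancelˡ-≡ m _ _ (trans (sym (+-assoc m k (2 * b))) (sym e))

sameParity⇒≢suc : ∀ {m n} → SameParity m n → m ≢ suc n
sameParity⇒≢suc {n = n} (a , b , e) refl =
  even≢odd b a (sym (+-cancelˡ-≡ n _ _ (trans (+-suc n (2 * a)) e)))

prime>2⇒odd : ∀ {n} → Prime n → 2 < n → ∃[ k ] n ≡ 1 + 2 * k
prime>2⇒odd {n} n-prime 2<n with n % 2 | m≡m%n+[m/n]*n n 2 | m%n<n n 2
... | 0 | n≡[n/2]*2 | _ with prime⇒irreducible n-prime (divides (n / 2) n≡[n/2]*2)
...   | inj₁ ()
...   | inj₂ 2≡n = contradiction 2<n (<-irrefl 2≡n)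
prime>2⇒odd {n} n-prime 2<n | 1 | n≡1+[n/2]*2 | _ = n / 2 , trans n≡1+[n/2]*2 (cong suc (*-comm (n / 2) 2))
prime>2⇒odd {n} n-prime 2<n | suc (suc _) | _ | s≤s (s≤s ())

∸-doubled : ∀ {m n k} → 2 * m ≡ 2 * n + k → n ≤ m × 2 * (m ∸ n) ≡ k
∸-doubled {m} {n} {k} e = *-cancelˡ-≤ 2 (subst (2 * n ≤_) (sym e) (m≤m+n (2 * n) k)) , (begin
  2 * (m ∸ n)        ≡⟨ *-distribˡ-∸ 2 m n ⟩
  2 * m ∸ 2 * n      ≡⟨ cong (_∸ 2 * n) e ⟩
  2 * n + k ∸ 2 * n  ≡⟨ m+n∸m≡n (2 * n) k ⟩
  k                  ∎)
  where open ≡-Reasoning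

half-double : ∀ k → 2 * k / 2 ≡ k
half-double k = trans (cong (_/ 2) (*-comm 2 k)) (m*n/n≡m k 2)

p′-odd : ∀ {p j} → p ≡ 1 + 2 * j → p′ p ≡ j
p′-odd {j = j} refl = half-double j

q′-odd : ∀ {q k} → q ≡ 1 + 2 * k → q′ q ≡ k
q′-odd {k = k} refl = half-double k

2d₁+q≡pq : ∀ {p j} q → p ≡ 1 + 2 * j → 2 * d₁ p q + q ≡ p * q
2d₁+q≡pq {j = j} q refl = begin
  2 * (p′ (1 + 2 * j) * q) + q  ≡⟨ cong (λ t → 2 * (t * q) + q) (p′-odd {j = j} refl) ⟩
  2 * (j * q) + q              ≡⟨ solve (j ∷ q ∷ []) ⟩
  (1 + 2 * j) * q              ∎
  where open ≡-Reasoning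

2d₂+p≡pq : ∀ p {q k} → q ≡ 1 + 2 * k → 2 * d₂ p q + p ≡ p * q
2d₂+p≡pq p {k = k} refl = begin
  2 * (p * q′ (1 + 2 * k)) + p  ≡⟨ cong (λ t → 2 * (p * t) + p) (q′-odd {k = k} refl) ⟩
  2 * (p * k) + p              ≡⟨ solve (p ∷ k ∷ []) ⟩
  p * (1 + 2 * k)              ∎
  where open ≡-Reasoning

2d₃+1≡pq : ∀ {p q j k} → p ≡ 1 + 2 * j → q ≡ 1 + 2 * k → 2 * d₃ p q + 1 ≡ p * q
2d₃+1≡pq {j = j} {k} refl refl = begin
  2 * ((pq ∸ 1) / 2) + 1  ≡⟨ cong (λ t → 2 * ((t ∸ 1) / 2) + 1) pq≡1+2m ⟩
  2 * (2 * m / 2) + 1     ≡⟨ cong (λ t → 2 * t + 1) (half-double m) ⟩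
  2 * m + 1               ≡⟨ trans pq≡1+2m (+-comm 1 (2 * m)) ⟨
  pq                      ∎
  where
  open ≡-Reasoning
  pq = (1 + 2 * j) * (1 + 2 * k)
  m = j + k + 2 * j * k
  pq≡1+2m : (1 + 2 * j) * (1 + 2 * k) ≡ 1 + 2 * (j + k + 2 * j * k)
  pq≡1+2m = solve (j ∷ k ∷ [])

fℕ : ℕ → ℕ → ℕ → ℕ → ℕ → ℕ → ℕ
fℕ p q x y z w = x * d₀ p q + y * d₁ p q + z * d₂ p q + w * d₃ p q

Representableℕ : ℕ → ℕ → ℕ → Set
Representableℕ p q n = Σ ℕ λ x → Σ ℕ λ y → Σ ℕ λ z → Σ ℕ λ w → fℕ p q x y z w ≡ n

f-pos : ∀ p q x y z w → f p q (ℤ.+ x) (ℤ.+ y) (ℤ.+ z) (ℤ.+ w) ≡ ℤ.+ fℕ p q x y z w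
f-pos p q x y z w
  rewrite sym (ℤ.pos-* x (d₀ p q)) | sym (ℤ.pos-* y (d₁ p q))
        | sym (ℤ.pos-* z (d₂ p q)) | sym (ℤ.pos-* w (d₃ p q))
        | sym (ℤ.pos-+ (x * d₀ p q) (y * d₁ p q))
        | sym (ℤ.pos-+ (x * d₀ p q + y * d₁ p q) (z * d₂ p q))
        | sym (ℤ.pos-+ (x * d₀ p q + y * d₁ p q + z * d₂ p q) (w * d₃ p q)) = refl

fℕ-doubled : ∀ {p q j k} → p ≡ 1 + 2 * j → q ≡ 1 + 2 * k → ∀ x y z w →
  2 * fℕ p q x y z w + (y * q + z * p + w) ≡ (2 * x + y + z + w) * (p * q)
fℕ-doubled {p} {q} {j} {k} p-odd q-odd x y z w = begin
  2 * fℕ p q x y z w + (y * q + z * p + w)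
    ≡⟨ regroup x y z w (p * q) (d₁ p q) (d₂ p q) (d₃ p q) q p ⟩
  2 * x * (p * q) + y * (2 * d₁ p q + q) + z * (2 * d₂ p q + p) + w * (2 * d₃ p q + 1)
    ≡⟨ cong₂ _+_ (cong₂ _+_ (cong (λ t → 2 * x * (p * q) + y * t) (2d₁+q≡pq {j = j} q p-odd))
                            (cong (z *_) (2d₂+p≡pq p {k = k} q-odd)))
                 (cong (w *_) (2d₃+1≡pq {j = j} {k} p-odd q-odd)) ⟩
  2 * x * (p * q) + y * (p * q) + z * (p * q) + w * (p * q)
    ≡⟨ solve (x ∷ y ∷ z ∷ w ∷ p ∷ q ∷ []) ⟩
  (2 * x + y + z + w) * (p * q) ∎
  where
  open ≡-Reasoning
  regroup : ∀ x y z w N D₁ D₂ D₃ q p →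
    2 * (x * N + y * D₁ + z * D₂ + w * D₃) + (y * q + z * p + w)
      ≡ 2 * x * N + y * (2 * D₁ + q) + z * (2 * D₂ + p) + w * (2 * D₃ + 1)
  regroup = solve-∀

isFrobeniusNumber : ∀ {p q g G} → g ≡ ℤ.+ G → 0 < G → ¬ Representableℕ p q G →
  (∀ n → G < n → Representableℕ p q n) → IsFrobeniusNumber p q g
isFrobeniusNumber {p} {q} {G = G} refl 0<G ¬rep rep = +<+ 0<G , ¬rep′ , rep′
  where
  ¬rep′ : ¬ Representable p q (ℤ.+ G)
  ¬rep′ (x , y , z , w , e) = ¬rep (x , y , z , w , ℤ.+-injective (trans (sym (f-pos p q x y z w)) e))
  rep′ : ∀ m → ℤ.+ G ℤ.< m → Representable p q m
  rep′ (ℤ.+ n) (+<+ G<n) with rep n G<n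
  ... | x , y , z , w , e = x , y , z , w , trans (f-pos p q x y z w) (cong ℤ.+_ e)

no-slack : ∀ {m n} → m ≡ n → ∀ k → m ≡ n + suc k → ⊥
no-slack {n = n} m≡n k m≡n+1+k = m+1+n≢m n (trans (sym m≡n+1+k) m≡n)

-- In each case the left side exceeds the right one by the positive amount given, once q is written as
-- p + 1 + t, as 2ap + 3 + v, or w as p − 1 + w′ respectively.
weighted-overrun : ∀ {p q a} j D w e → p ≡ 3 + 2 * a → p < q → (p ∸ 3) * p + 3 ≤ q →
  1 ≤ j → 1 ≤ D → (D ≡ 1 → p ≤ suc w) →
  j * p * p + D * q + p * w + p * e ≢ 4 * a * p + q + p * j + p * D + w + 1
weighted-overrun {a = a} (suc (suc j)) (suc D) w e refl p<q _ _ _ _ eq with m≤n⇒∃[o]m+o≡n p<q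
... | t , refl = no-slack eq
  (7 + 6 * a + j * (3 + 2 * a) * (2 + 2 * a) + D * (1 + t) + (2 + 2 * a) * w + (3 + 2 * a) * e)
  (solve (a ∷ j ∷ D ∷ w ∷ e ∷ t ∷ []))
weighted-overrun {a = a} 1 (suc (suc D)) w e refl _ q-large _ _ _ eq with m≤n⇒∃[o]m+o≡n q-large
... | v , refl = no-slack eq
  (1 + v + D * (2 * a * (2 + 2 * a) + v) + (2 + 2 * a) * w + (3 + 2 * a) * e)
  (solve (a ∷ D ∷ w ∷ e ∷ v ∷ []))
weighted-overrun {q = q} {a = a} 1 1 w e refl _ _ _ _ p≤1+w eq with m≤n⇒∃[o]m+o≡n (p≤1+w refl)
... | w′ , refl = no-slack eq
  (5 + 4 * a + (2 + 2 * a) * w′ + (3 + 2 * a) * e)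
  (solve (a ∷ q ∷ w′ ∷ e ∷ []))

module OddFrobenius
  (p q a b κ λ′ : ℕ)
  (p≡3+2a : p ≡ 3 + 2 * a) (q≡1+2b : q ≡ 1 + 2 * b)
  (q≡κp+λ : q ≡ κ * p + λ′) (λ<p : λ′ < p) (p<q : p < q)
  (q-large : (p ∸ 3) * p + 3 ≤ q)
  where

  instance
    p-nonZero : NonZero p
    p-nonZero = subst NonZero (sym p≡3+2a) _
    q-nonZero : NonZero q
    q-nonZero = subst NonZero (sym q≡1+2b) _
    N-nonZero : NonZero (p * q)
    N-nonZero = m*n≢0 p q

  N σ : ℕ
  N = p * q
  σ = 4 * a + κ

  p≡1+2[1+a] : p ≡ 1 + 2 * suc a
  p≡1+2[1+a] = trans p≡3+2a (solve (a ∷ []))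

  F-doubled : ∀ x y z w → 2 * fℕ p q x y z w + (y * q + z * p + w) ≡ (2 * x + y + z + w) * N
  F-doubled = fℕ-doubled {j = suc a} {b} p≡1+2[1+a] q≡1+2b

  -- g₀ = f(p′ − 1, p − 1, κ, −1) = F₀ − d₃
  F₀ : ℕ
  F₀ = fℕ p q a (2 + 2 * a) κ 0

  F₀-doubled : 2 * F₀ ≡ 2 * d₃ p q + (σ * N + λ′ + 1)
  F₀-doubled = +-cancelʳ-≡ R _ _ (trans (F-doubled a (2 + 2 * a) κ 0) (sym (begin
    2 * d₃ p q + (σ * N + λ′ + 1) + R
      ≡⟨ regroup (d₃ p q) (σ * N + λ′) R ⟩
    (2 * d₃ p q + 1) + (σ * N + λ′ + R)
      ≡⟨ cong (_+ (σ * N + λ′ + R)) (2d₃+1≡pq {j = suc a} {b} p≡1+2[1+a] q≡1+2b) ⟩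
    p * q + ((4 * a + κ) * (p * q) + λ′ + ((2 + 2 * a) * q + κ * p + 0))
      ≡⟨ solve (p ∷ q ∷ a ∷ κ ∷ λ′ ∷ []) ⟩
    p * q + (4 * a + κ) * (p * q) + (2 + 2 * a) * q + (κ * p + λ′)
      ≡⟨ cong (p * q + (4 * a + κ) * (p * q) + (2 + 2 * a) * q +_) q≡κp+λ ⟨
    p * q + (4 * a + κ) * (p * q) + (2 + 2 * a) * q + q
      ≡⟨ solve (p ∷ q ∷ a ∷ κ ∷ []) ⟩
    p * q + (4 * a + κ) * (p * q) + (3 + 2 * a) * q
      ≡⟨ cong (λ t → p * q + (4 * a + κ) * (p * q) + t * q) p≡3+2a ⟨
    p * q + (4 * a + κ) * (p * q) + p * q
      ≡⟨ solve (p ∷ q ∷ a ∷ κ ∷ []) ⟩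
    (2 * a + (2 + 2 * a) + κ + 0) * (p * q) ∎)))
    where
    open ≡-Reasoning
    R = (2 + 2 * a) * q + κ * p + 0
    regroup : ∀ D X Y → 2 * D + (X + 1) + Y ≡ (2 * D + 1) + (X + Y)
    regroup = solve-∀

  G : ℕ
  G = F₀ ∸ d₃ p q

  d₃≤F₀×G-doubled : d₃ p q ≤ F₀ × 2 * G ≡ σ * N + λ′ + 1
  d₃≤F₀×G-doubled = ∸-doubled F₀-doubled

  G-doubled : 2 * G ≡ σ * N + λ′ + 1
  G-doubled = proj₂ d₃≤F₀×G-doubled

  g₀≡G : g₀ p q κ ≡ ℤ.+ G
  g₀≡G = begin
    g₀ p q κ
      ≡⟨ cong₂ (λ X Y → f p q X Y (ℤ.+ κ) (ℤ.- ℤ.+ 1))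
               (cong (λ t → ℤ.+ t ℤ.- ℤ.+ 1) (p′-odd {j = suc a} p≡1+2[1+a]))
               (cong (λ t → ℤ.+ t ℤ.- ℤ.+ 1) p≡3+2a) ⟩
    A ℤ.+ ℤ.- ℤ.+ 1 ℤ.* ℤ.+ d₃ p q
      ≡⟨ cong (ℤ._+_ A) (ℤ.-1*i≡-i (ℤ.+ d₃ p q)) ⟩
    A ℤ.- ℤ.+ d₃ p q
      ≡⟨ cong (ℤ._- ℤ.+ d₃ p q) (trans (sym (ℤ.+-identityʳ A)) (f-pos p q a (2 + 2 * a) κ 0)) ⟩
    ℤ.+ F₀ ℤ.- ℤ.+ d₃ p q
      ≡⟨ ℤ.m-n≡m⊖n F₀ (d₃ p q) ⟩
    F₀ ℤ.⊖ d₃ p q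
      ≡⟨ ℤ.⊖-≥ (proj₁ d₃≤F₀×G-doubled) ⟩
    ℤ.+ G ∎
    where
    open ≡-Reasoning
    A = ℤ.+ a ℤ.* ℤ.+ d₀ p q ℤ.+ ℤ.+ (2 + 2 * a) ℤ.* ℤ.+ d₁ p q ℤ.+ ℤ.+ κ ℤ.* ℤ.+ d₂ p q

  G-positive : 0 < G
  G-positive with G | G-doubled
  ... | zero  | 0≡ = contradiction (sym 0≡) (m+1+n≢0 (σ * N + λ′))
  ... | suc _ | _  = s≤s z≤n

  residue≡q⇒p≤1+w : ∀ {z w} → z * p + w + λ′ + 1 ≡ q → p ≤ suc w
  residue≡q⇒p≤1+w {z} {w} residue≡q = ∣⇒≤ (∣m+n∣m⇒∣n (divides κ zp+[1+w]≡κp) (divides z refl))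
    where
    open ≡-Reasoning
    zp+[1+w]≡κp : z * p + suc w ≡ κ * p
    zp+[1+w]≡κp = +-cancelʳ-≡ λ′ _ _ (begin
      z * p + (1 + w) + λ′  ≡⟨ solve (z ∷ p ∷ w ∷ λ′ ∷ []) ⟩
      z * p + w + λ′ + 1    ≡⟨ trans residue≡q q≡κp+λ ⟩
      κ * p + λ′            ∎)

  -- p times the coin budget, with y and z eliminated through the two residue equations.
  weighted-budget : ∀ {j D y z w e} → z * p + w + λ′ + 1 ≡ D * q → y + D ≡ j * p → y + z + w + e ≡ σ + j →
    j * p * p + D * q + p * w + p * e ≡ 4 * a * p + q + p * j + p * D + w + 1
  weighted-budget {j} {D} {y} {z} {w} {e} residue≡Dq y+D≡jp budget = begin
    j * p * p + D * q + p * w + p * e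
      ≡⟨ cong₂ (λ u v → u * p + v + p * w + p * e) (sym y+D≡jp) (sym residue≡Dq) ⟩
    (y + D) * p + (z * p + w + λ′ + 1) + p * w + p * e
      ≡⟨ solve (y ∷ D ∷ p ∷ z ∷ w ∷ λ′ ∷ e ∷ []) ⟩
    p * (y + z + w + e) + p * D + w + λ′ + 1
      ≡⟨ cong (λ s → p * s + p * D + w + λ′ + 1) budget ⟩
    p * (4 * a + κ + j) + p * D + w + λ′ + 1
      ≡⟨ solve (p ∷ a ∷ κ ∷ j ∷ D ∷ w ∷ λ′ ∷ []) ⟩
    4 * a * p + (κ * p + λ′) + p * j + p * D + w + 1
      ≡⟨ cong (λ t → 4 * a * p + t + p * j + p * D + w + 1) q≡κp+λ ⟨
    4 * a * p + q + p * j + p * D + w + 1 ∎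
    where open ≡-Reasoning

  2x+c≡c+2x : ∀ x y z w → 2 * x + y + z + w ≡ y + z + w + 2 * x
  2x+c≡c+2x = solve-∀

  split-residue : ∀ {j y z w} → y * q + z * p + w + λ′ + 1 ≡ j * N → y * q + (z * p + w + λ′ + 1) ≡ j * p * q
  split-residue {j} {y} {z} {w} e = trans (regroup (y * q) (z * p) w λ′) (trans e (sym (*-assoc j p q)))
    where
    regroup : ∀ Y Z W L → Y + (Z + W + L + 1) ≡ Y + Z + W + L + 1
    regroup = solve-∀

  ¬representable-G : ¬ Representableℕ p q G
  ¬representable-G (x , y , z , w , F≡G) with multiple-gap {σ} {2 * x + y + z + w} {o = N} σN+T+λ+1≡SN
    where
    σN+T+λ+1≡SN : σ * N + (y * q + z * p + w + λ′ + 1) ≡ (2 * x + y + z + w) * N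
    σN+T+λ+1≡SN = begin
      σ * N + (y * q + z * p + w + λ′ + 1)     ≡⟨ regroup (σ * N) (y * q + z * p + w) λ′ ⟩
      σ * N + λ′ + 1 + (y * q + z * p + w)     ≡⟨ cong (λ t → t + (y * q + z * p + w)) G-doubled ⟨
      2 * G + (y * q + z * p + w)              ≡⟨ cong (λ t → 2 * t + (y * q + z * p + w)) F≡G ⟨
      2 * fℕ p q x y z w + (y * q + z * p + w) ≡⟨ F-doubled x y z w ⟩
      (2 * x + y + z + w) * N                  ∎
      where
      open ≡-Reasoning
      regroup : ∀ X T L → X + (T + L + 1) ≡ X + L + 1 + T
      regroup = solve-∀
  ... | zero , _ , residue≡0 = m+1+n≢0 _ residue≡0
  ... | suc j , σ+j≡S , residue≡jN
    with multiple-gap {y} {suc j * p} {z * p + w + λ′ + 1} {q} (split-residue {suc j} {y} {z} {w} residue≡jN)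
  ...   | zero , _ , residue≡0 = m+1+n≢0 _ residue≡0
  ...   | suc D , y+D≡jp , residue≡Dq =
    weighted-overrun {p} {q} {a} (suc j) (suc D) w (2 * x) p≡3+2a p<q q-large (s≤s z≤n) (s≤s z≤n)
      (λ { refl → residue≡q⇒p≤1+w {z} {w} (trans residue≡Dq (*-identityˡ q)) })
      (weighted-budget residue≡Dq y+D≡jp (sym (trans σ+j≡S (2x+c≡c+2x x y z w))))

  p+p+κ≡σ+6 : p + p + κ ≡ 3 + σ + 3
  p+p+κ≡σ+6 = begin
    p + p + κ                    ≡⟨ cong (λ t → t + t + κ) p≡3+2a ⟩
    (3 + 2 * a) + (3 + 2 * a) + κ  ≡⟨ solve (a ∷ κ ∷ []) ⟩
    3 + (4 * a + κ) + 3          ∎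
    where open ≡-Reasoning

  digit-budget-below-κ : ∀ {y z w} → y < p → w < p → z < κ →
    ∃[ s ] (y + z + w + s ≡ 3 + σ × N ≤ y * q + z * p + w + λ′ + 1 + s * q)
  digit-budget-below-κ {y} {z} {w} y<p w<p z<κ
    with m≤n⇒∃[o]m+o≡n y<p | m≤n⇒∃[o]m+o≡n w<p | m≤n⇒∃[o]m+o≡n z<κ
  ... | sy , y+sy≡p | sw , w+sw≡p | sz , z+sz≡κ = sy + sz + sw , count , residue
    where
    count : y + z + w + (sy + sz + sw) ≡ 3 + σ
    count = +-cancelʳ-≡ 3 _ _ (begin
      y + z + w + (sy + sz + sw) + 3                ≡⟨ solve (y ∷ z ∷ w ∷ sy ∷ sz ∷ sw ∷ []) ⟩
      (1 + y + sy) + (1 + w + sw) + (1 + z + sz)    ≡⟨ cong₂ _+_ (cong₂ _+_ y+sy≡p w+sw≡p) z+sz≡κ ⟩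
      p + p + κ                                     ≡⟨ p+p+κ≡σ+6 ⟩
      3 + σ + 3                                     ∎)
      where open ≡-Reasoning
    exact : y * q + z * p + w + λ′ + 1 + (sy * q + sz * p + sw) ≡ N
    exact = +-cancelʳ-≡ (q + p) _ _ (begin
      y * q + z * p + w + λ′ + 1 + (sy * q + sz * p + sw) + (q + p)
        ≡⟨ solve (y ∷ q ∷ z ∷ p ∷ w ∷ λ′ ∷ sy ∷ sz ∷ sw ∷ []) ⟩
      (1 + y + sy) * q + ((1 + z + sz) * p + λ′) + (1 + w + sw)
        ≡⟨ cong₂ _+_ (cong₂ (λ u v → u * q + (v * p + λ′)) y+sy≡p z+sz≡κ) w+sw≡p ⟩
      p * q + (κ * p + λ′) + p
        ≡⟨ cong (λ t → p * q + t + p) q≡κp+λ ⟨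
      p * q + q + p
        ≡⟨ +-assoc (p * q) q p ⟩
      p * q + (q + p) ∎)
      where open ≡-Reasoning
    residue : N ≤ y * q + z * p + w + λ′ + 1 + (sy + sz + sw) * q
    residue = begin
      N                                                           ≡⟨ exact ⟨
      y * q + z * p + w + λ′ + 1 + (sy * q + sz * p + sw)         ≤⟨ +-monoʳ-≤ (y * q + z * p + w + λ′ + 1)
                                                                       (+-mono-≤ (+-monoʳ-≤ (sy * q) (*-monoʳ-≤ sz (<⇒≤ p<q)))
                                                                                 (m≤m*n sw q)) ⟩
      y * q + z * p + w + λ′ + 1 + (sy * q + sz * q + sw * q)     ≡⟨ cong (y * q + z * p + w + λ′ + 1 +_)
                                                                       (solve (sy ∷ sz ∷ sw ∷ q ∷ [])) ⟩
      y * q + z * p + w + λ′ + 1 + (sy + sz + sw) * q             ∎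
      where open ≤-Reasoning

  digit-budget-at-κ : ∀ {y w} → y < p → w < λ′ →
    ∃[ s ] (y + κ + w + s ≡ 3 + σ × N ≤ y * q + κ * p + w + λ′ + 1 + s * q)
  digit-budget-at-κ {y} {w} y<p w<λ
    with m≤n⇒∃[o]m+o≡n y<p | m≤n⇒∃[o]m+o≡n w<λ | m≤n⇒∃[o]m+o≡n λ<p
  ... | sy , y+sy≡p | sw , w+sw≡λ | sl , λ+sl≡p = sy + sw + sl , count , residue
    where
    count : y + κ + w + (sy + sw + sl) ≡ 3 + σ
    count = +-cancelʳ-≡ 3 _ _ (begin
      y + κ + w + (sy + sw + sl) + 3                 ≡⟨ solve (y ∷ κ ∷ w ∷ sy ∷ sw ∷ sl ∷ []) ⟩
      (1 + y + sy) + (1 + (1 + w + sw) + sl) + κ     ≡⟨ cong (λ t → (1 + y + sy) + (1 + t + sl) + κ) w+sw≡λ ⟩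
      (1 + y + sy) + (1 + λ′ + sl) + κ               ≡⟨ cong₂ (λ u v → u + v + κ) y+sy≡p λ+sl≡p ⟩
      p + p + κ                                      ≡⟨ p+p+κ≡σ+6 ⟩
      3 + σ + 3                                      ∎)
      where open ≡-Reasoning
    exact : y * q + κ * p + w + λ′ + 1 + sy * q ≡ N + suc w
    exact = +-cancelʳ-≡ q _ _ (begin
      y * q + κ * p + w + λ′ + 1 + sy * q + q        ≡⟨ solve (y ∷ q ∷ κ ∷ p ∷ w ∷ λ′ ∷ sy ∷ []) ⟩
      (1 + y + sy) * q + (κ * p + λ′) + (1 + w)      ≡⟨ cong₂ (λ u v → u * q + v + (1 + w)) y+sy≡p (sym q≡κp+λ) ⟩
      p * q + q + (1 + w)                            ≡⟨ solve (p ∷ q ∷ w ∷ []) ⟩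
      p * q + (1 + w) + q                            ∎)
      where open ≡-Reasoning
    residue : N ≤ y * q + κ * p + w + λ′ + 1 + (sy + sw + sl) * q
    residue = begin
      N                                                ≤⟨ m≤m+n N (suc w) ⟩
      N + suc w                                        ≡⟨ exact ⟨
      y * q + κ * p + w + λ′ + 1 + sy * q              ≤⟨ +-monoʳ-≤ (y * q + κ * p + w + λ′ + 1)
                                                            (*-monoˡ-≤ q (≤-trans (m≤m+n sy sw) (m≤m+n (sy + sw) sl))) ⟩
      y * q + κ * p + w + λ′ + 1 + (sy + sw + sl) * q  ∎
      where open ≤-Reasoning

  -- The mixed-radix digits of a residue cost at most 3 + σ coins, and exactly that many only if
  -- the residue is at least pq − λ′ − 1.
  digit-budget : ∀ {y z w} → y < p → w < p → z * p + w < q →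
    ∃[ s ] (y + z + w + s ≡ 3 + σ × N ≤ y * q + z * p + w + λ′ + 1 + s * q)
  digit-budget {y} {z} {w} y<p w<p zp+w<q with m≤n⇒m<n∨m≡n (m<1+n⇒m≤n z<1+κ)
    where
    z<1+κ : z < suc κ
    z<1+κ = *-cancelʳ-< p z (suc κ) (begin-strict
      z * p        ≤⟨ m≤m+n (z * p) w ⟩
      z * p + w    <⟨ zp+w<q ⟩
      q            ≡⟨ q≡κp+λ ⟩
      κ * p + λ′   <⟨ +-monoʳ-< (κ * p) λ<p ⟩
      κ * p + p    ≡⟨ +-comm (κ * p) p ⟩
      suc κ * p    ∎)
      where open ≤-Reasoning
  ... | inj₁ z<κ = digit-budget-below-κ y<p w<p z<κ
  ... | inj₂ refl = digit-budget-at-κ y<p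
    (+-cancelˡ-< (κ * p) w λ′ (subst (κ * p + w <_) q≡κp+λ zp+w<q))

  residue-parity : ∀ {n k y z w} → 2 * n + (y * q + z * p + w) ≡ k * N → SameParity (y + z + w) k
  residue-parity {n} {k} {y} {z} {w} e = n + y * b + z * suc a , k * (1 + a + 3 * b + 2 * a * b) , (begin
    y + z + w + 2 * (n + y * b + z * suc a)             ≡⟨ solve (y ∷ z ∷ w ∷ n ∷ b ∷ a ∷ []) ⟩
    2 * n + (y * (1 + 2 * b) + z * (3 + 2 * a) + w)     ≡⟨ cong₂ (λ u v → 2 * n + (y * u + z * v + w)) q≡1+2b p≡3+2a ⟨
    2 * n + (y * q + z * p + w)                         ≡⟨ e ⟩
    k * (p * q)                                         ≡⟨ cong₂ (λ u v → k * (u * v)) p≡3+2a q≡1+2b ⟩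
    k * ((3 + 2 * a) * (1 + 2 * b))                     ≡⟨ solve (k ∷ a ∷ b ∷ []) ⟩
    k + 2 * (k * (1 + a + 3 * b + 2 * a * b))           ∎)
    where open ≡-Reasoning

  digit-sum≤multiplier : ∀ {n k c s T} → G < n → 2 * n + T ≡ k * N →
    c + s ≡ 3 + σ → N ≤ T + λ′ + 1 + s * q → SameParity c k → c ≤ k
  digit-sum≤multiplier {n} {k} {c} {s} {T} G<n 2n+T≡kN c+s≡3+σ N≤ parity =
    m<1+n⇒m≤n (≤∧≢⇒< (c≤1+k s c+s≡3+σ N≤) (sameParity⇒≢suc parity))
    where
    2G<2n : 2 * G < 2 * n
    2G<2n = *-monoʳ-< 2 G<n
    σ<k : σ < k
    σ<k = *-cancelʳ-< N σ k (begin-strict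
      σ * N                 ≤⟨ m≤m+n (σ * N) (λ′ + 1) ⟩
      σ * N + (λ′ + 1)      ≡⟨ +-assoc (σ * N) λ′ 1 ⟨
      σ * N + λ′ + 1        ≡⟨ G-doubled ⟨
      2 * G                 <⟨ 2G<2n ⟩
      2 * n                 ≤⟨ m≤m+n (2 * n) T ⟩
      2 * n + T             ≡⟨ 2n+T≡kN ⟩
      k * N                 ∎)
      where open ≤-Reasoning
    1+σ<k : N ≤ T + λ′ + 1 → suc σ < k
    1+σ<k N≤T+λ+1 = *-cancelʳ-< N (suc σ) k (begin-strict
      N + σ * N             ≤⟨ +-monoˡ-≤ (σ * N) N≤T+λ+1 ⟩
      T + λ′ + 1 + σ * N    ≡⟨ regroup T λ′ (σ * N) ⟩
      σ * N + λ′ + 1 + T    ≡⟨ cong (_+ T) G-doubled ⟨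
      2 * G + T             <⟨ +-monoˡ-< T 2G<2n ⟩
      2 * n + T             ≡⟨ 2n+T≡kN ⟩
      k * N                 ∎)
      where
      open ≤-Reasoning
      regroup : ∀ T L X → T + L + 1 + X ≡ X + L + 1 + T
      regroup = solve-∀
    c≤1+k : ∀ s → c + s ≡ 3 + σ → N ≤ T + λ′ + 1 + s * q → c ≤ suc k
    c≤1+k zero c+0≡3+σ N≤T+λ+1 =
      subst (_≤ suc k) (trans (sym c+0≡3+σ) (+-identityʳ c)) (s≤s (1+σ<k (subst (N ≤_) (+-identityʳ _) N≤T+λ+1)))
    c≤1+k (suc s) c+1+s≡3+σ _ =
      ≤-trans (subst (c ≤_) (suc-injective (trans (sym (+-suc c s)) c+1+s≡3+σ)) (m≤m+n c s)) (s≤s σ<k)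

  representable-above-G : ∀ n → G < n → Representableℕ p q n
  representable-above-G n G<n =
    let k , r , 2n+r≡kN , r<N = round-up-to-multiple (2 * n) N
        y , z , w , r≡T , y<p , zp+w<q , w<p = mixed-radix {p = p} {q} r<N
        T = y * q + z * p + w
        2n+T≡kN = subst (λ t → 2 * n + t ≡ k * N) r≡T 2n+r≡kN
        s , c+s≡3+σ , N≤ = digit-budget y<p w<p zp+w<q
        parity = residue-parity {n} {k} {y} {z} {w} 2n+T≡kN
        x , k≡c+2x = sameParity∧≤⇒even-gap parity
                       (digit-sum≤multiplier {n} {k} {y + z + w} {s} {T} G<n 2n+T≡kN c+s≡3+σ N≤ parity)
    in x , y , z , w , *-cancelˡ-≡ (fℕ p q x y z w) n 2 (+-cancelʳ-≡ T (2 * fℕ p q x y z w) (2 * n) (begin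
      2 * fℕ p q x y z w + T         ≡⟨ F-doubled x y z w ⟩
      (2 * x + y + z + w) * N        ≡⟨ cong (_* N) (2x+c≡c+2x x y z w) ⟩
      (y + z + w + 2 * x) * N        ≡⟨ cong (_* N) k≡c+2x ⟨
      k * N                          ≡⟨ 2n+T≡kN ⟨
      2 * n + T                      ∎))
    where open ≡-Reasoning

  frobenius : IsFrobeniusNumber p q (g₀ p q κ)
  frobenius = isFrobeniusNumber {p} {q} g₀≡G G-positive ¬representable-G representable-above-G

corollary2p2 : (p q : ℕ) → Prime p → Prime q → 2 < p → p < q →
    (κ λ′ : ℕ) → q ≡ κ * p + λ′ → 1 ≤ λ′ → λ′ ≤ p ∸ 1 →
    q ≥ (p ∸ 3) * p + 3 →
    IsFrobeniusNumber p q (g₀ p q κ)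
corollary2p2 p q p-prime q-prime 2<p p<q κ λ′ q≡κp+λ _ λ≤p∸1 q-large
  with prime>2⇒odd p-prime 2<p | prime>2⇒odd q-prime (<-trans 2<p p<q)
... | zero , p≡1 | _ = contradiction (subst (2 <_) p≡1 2<p) λ { (s≤s ()) }
... | suc a , p≡1+2[1+a] | b , q≡1+2b =
  OddFrobenius.frobenius p q a b κ λ′ (trans p≡1+2[1+a] (solve (a ∷ []))) q≡1+2b q≡κp+λ
    (m≤pred[n]⇒suc[m]≤n {{prime⇒nonZero p-prime}} λ≤p∸1) p<q q-large
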